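{- Let $G'$ be a graph, let $0<\epsilon_1<1$, and let $G$ be the graph constructed from $G'$ and $\epsilon_1$ as described in the context, with $k=\lceil\epsilon_1|V(G')|\rceil$. If $G$ contains a shattered set of size at least $k$, then $G'$ admits a proper $3$-coloring.
   Context: Construction: set $k=\lceil\epsilon_1|V(G')|\rceil$ and arbitrarily partition $V(G')$ into $k$ parts $V_1,\dots,V_k$, each of size at most $p=\lceil 1/\epsilon_1\rceil$. For each $i\in[k]$, let $U_i$ be a set of new vertices containing one vertex for each proper $3$-coloring of $G'[V_i]$; let $X=\bigcup_{i\in[k]}U_i$ (an independent set in $G$). The remaining vertices of $G$ form an independent set $Y=I_1\cup I_2\cup I_{\ge3}$: for each $u\in X$, $I_1$ contains a vertex adjacent only to $u$; for all distinct $i,j\in[k]$, $u\in U_i$, $v\in U_j$, $I_2$ contains a vertex $w$ which is adjacent to both $u$ and $v$ if $u$ and $v$ are consistent (the union of their colorings is a proper coloring of $G'[V_i\cup V_j]$) and otherwise has no neighbors; for each $A\subseteq[k]$ with $|A|\ge3$, $I_{\ge3}$ contains a vertex adjacent to every vertex of $U_j$ for all $j\in A$. These are all edges of $G$. A set $S\subseteq V(G)$ is shattered in $G$ if for every $S'\subseteq S$ there is a vertex $w\in V(G)$ with $N(w)\cap S=S'$, where $N(w)$ is the open neighborhood. -}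

module Defs where

open import Data.Nat as ℕ using (ℕ; _≤_)
open import Data.Integer as ℤ using (ℤ)
open import Data.Rational as ℚ using (ℚ; 0ℚ; 1ℚ; _/_; 1/_; floor; ceiling)
open import Data.Rational.Properties using (pos⇒nonZero)
open import Data.Fin as Fin using (Fin)
open import Data.Fin.Subset using (Subset; _∈_; ∣_∣)
open import Data.List using (length; filter; allFin)
open import Data.Product using (Σ; ∃; ∃-syntax; _×_; _,_; proj₁; proj₂)
open import Data.Sum using (_⊎_; inj₁; inj₂)
open import Data.Empty using (⊥)
open import Function.Bundles using (_⇔_)
open import Function.Definitions using (Injective)
open import Relation.Binary.PropositionalEquality using (_≡_; _≢_)

-- Finite (simple) graphs G' are given by n : ℕ and an adjacency relation
-- on Fin n (symmetry / irreflexivity are hypotheses of the theorem).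

Proper3Coloring : (n : ℕ) → (Fin n → Fin n → Set) → Set
Proper3Coloring n Adj =
  Σ (Fin n → Fin 3) λ c → ∀ u v → Adj u v → c u ≢ c v

kOf : ℚ → ℕ → ℕ
kOf ε n = ℤ.∣ ceiling (ε ℚ.* (ℤ.+ n / 1)) ∣

pOf : (ε : ℚ) → 0ℚ ℚ.< ε → ℕ
pOf ε h = ℤ.∣ ceiling ((1/ ε) {{pos⇒nonZero ε {{ℚ.positive h}}}}) ∣

partSize : {n k : ℕ} → (Fin n → Fin k) → Fin k → ℕ
partSize {n} part i = length (filter (λ v → part v Fin.≟ i) (allFin n))

-- Shattered sets in a graph with vertex type V and adjacency Adj.
-- S : Fin m → V is a set of size m (S injective); S' ⊆ S is a Subset m.

Shattered : {V : Set} → (V → V → Set) → {m : ℕ} → (Fin m → V) → Set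
Shattered {V} Adj {m} S =
  ∀ (S' : Subset m) → ∃[ w ] (∀ j → (Adj w (S j) ⇔ (j ∈ S')))

HasShatteredSetOfSize≥ : {V : Set} → (V → V → Set) → ℕ → Set
HasShatteredSetOfSize≥ {V} Adj k =
  ∃[ m ] Σ (Fin m → V) λ S → k ≤ m × Injective _≡_ _≡_ S × Shattered Adj S

module Construction (n : ℕ) (Adj' : Fin n → Fin n → Set)
                    (k : ℕ) (part : Fin n → Fin k) where

  Part : Fin k → Set
  Part i = Σ (Fin n) λ v → part v ≡ i

  record Col (i : Fin k) : Set where
    constructor mkCol
    field
      col    : Part i → Fin 3
      proper : (u v : Part i) → Adj' (proj₁ u) (proj₁ v) → col u ≢ col v
  open Col public

  -- U_i has one vertex per proper 3-colouring of G'[V_i]; X = ⋃ U_i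
  U : Fin k → Set
  U i = Col i

  X : Set
  X = Σ (Fin k) U

  unionCol : {i j : Fin k} → Col i → Col j →
             (v : Fin n) → (part v ≡ i) ⊎ (part v ≡ j) → Fin 3
  unionCol c d v (inj₁ p) = col c (v , p)
  unionCol c d v (inj₂ q) = col d (v , q)

  Consistent : {i j : Fin k} → U i → U j → Set
  Consistent {i} {j} c d =
    ∀ (a b : Fin n) (ha : (part a ≡ i) ⊎ (part a ≡ j))
      (hb : (part b ≡ i) ⊎ (part b ≡ j)) →
    Adj' a b → unionCol c d a ha ≢ unionCol c d b hb

  -- vertices of G:  X ∪ I₁ ∪ I₂ ∪ I≥3
  -- (I₂ has one vertex per unordered pair {u,v}, u ∈ U_i, v ∈ U_j, i ≠ j,
  --  represented with i < j)
  data VG : Set where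
    xv   : X → VG
    i₁   : X → VG
    i₂   : (i j : Fin k) → i Fin.< j → U i → U j → VG
    i≥3  : (A : Subset k) → 3 ≤ ∣ A ∣ → VG

  -- edges between Y = I₁ ∪ I₂ ∪ I≥3 (first argument) and X (second)
  EdgeYX : VG → X → Set
  EdgeYX (xv _)            x          = ⊥
  EdgeYX (i₁ u)            x          = x ≡ u
  EdgeYX (i₂ i j _ u v)    x          =
    Consistent u v × (x ≡ (i , u) ⊎ x ≡ (j , v))
  EdgeYX (i≥3 A _)         (j , _)    = j ∈ A

  AdjG : VG → VG → Set
  AdjG (xv x) w      = EdgeYX w x
  AdjG w      (xv x) = EdgeYX w x
  AdjG _      _      = ⊥

-- Let S be a shattered set of size m ≥ k. The witness of S itself is adjacent to all of S, and
-- every edge of G joins X to Y, so S ⊆ X or S ⊆ Y.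
-- If S ⊆ X, two vertices of S in the same U_i could not be separated: an I₂-vertex sees at most
-- two vertices of X, in different parts, and an I≥3-vertex sees whole parts. So S meets each U_i
-- exactly once; the witness of two of them must then be the I₂-vertex of a consistent pair, and
-- the chosen colourings glue to a 3-colouring of G'.
-- If S ⊆ Y, a vertex of I₁ or I₂ has too few neighbours to tell apart the subsets of S containing
-- it, unless k ≤ 2, where its neighbourhood already yields a colouring (as does any vertex of X
-- when k ≤ 1); and if S ⊆ I≥3, the parts of the witnesses of the singletons and of S would be
-- m + 1 distinct elements of [k].
module Submission where

open import Defs
open import Data.Nat using (ℕ; _≤_)
open import Data.Rational using (ℚ; 0ℚ; 1ℚ; _<_)
open import Data.Fin using (Fin)
open import Data.Product using (∃-syntax)
open import Data.Empty using (⊥)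
open import Relation.Binary.PropositionalEquality using (_≡_)

import Data.Nat as ℕ
open import Data.Nat using (zero; suc; _+_; z≤n; s≤s; _≤?_)
open import Data.Nat.Properties
  using (≤-trans; ≤-reflexive; ≤-antisym; <⇒≱; <-≤-trans; ≤-<-trans; ≰⇒>;
         +-suc; +-comm; +-monoʳ-≤; n≤1+n)
import Data.Fin as Fin
open import Data.Fin using (zero; suc; punchOut)
open import Data.Fin.Properties
  using (_≟_; any?; all?; ¬∀⟶∃¬; <-cmp; <-irrefl; <-asym; punchOut-injective; injective⇒≤)
open import Data.Fin.Subset
  using (Subset; Nonempty; _∈_; _∉_; ∣_∣; ⁅_⁆; _∪_; ∁; _⊆_; ⊤; inside; outside)
open import Data.Fin.Subset.Properties
  using (_∈?_; ∈⊤; ∣⊤∣≡n; ∣p∣≤n; ∣p∣≡n⇒p≡⊤; ∣⁅x⁆∣≡1; x∈⁅x⁆; x∈⁅y⁆⇒x≡y; x≢y⇒x∉⁅y⁆;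
         x∉p⇒x∈∁p; x∈∁p⇒x∉p; p⊆p∪q; q⊆p∪q; x∈p∪q⁻; p⊆q⇒∣p∣≤∣q∣)
open import Data.Product using (Σ; ∃; _×_; _,_; proj₁; proj₂; map₂; uncurry)
open import Data.Sum using (_⊎_; inj₁; inj₂; [_,_]′)
import Data.Sum as Sum
open import Data.Empty using (⊥-elim)
open import Data.Vec using ([]; _∷_)
open import Function using (_∘_; id)
open import Function.Bundles using (_⇔_; Equivalence)
open import Function.Definitions using (Injective)
open import Relation.Nullary using (Dec; yes; no)
open import Relation.Nullary.Decidable using (_×-dec_; ¬?)
open import Relation.Binary using (tri<; tri≈; tri>)
open import Relation.Binary.PropositionalEquality using (_≢_; refl; sym; trans; cong; subst; subst₂)

open Equivalence using (to; from)

∣p∪q∣≤∣p∣+∣q∣ : ∀ {n} (p q : Subset n) → ∣ p ∪ q ∣ ≤ ∣ p ∣ + ∣ q ∣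
∣p∪q∣≤∣p∣+∣q∣ []            []            = z≤n
∣p∪q∣≤∣p∣+∣q∣ (outside ∷ p) (outside ∷ q) = ∣p∪q∣≤∣p∣+∣q∣ p q
∣p∪q∣≤∣p∣+∣q∣ (inside ∷ p)  (outside ∷ q) = s≤s (∣p∪q∣≤∣p∣+∣q∣ p q)
∣p∪q∣≤∣p∣+∣q∣ (outside ∷ p) (inside ∷ q)  =
  ≤-trans (s≤s (∣p∪q∣≤∣p∣+∣q∣ p q)) (≤-reflexive (sym (+-suc ∣ p ∣ ∣ q ∣)))
∣p∪q∣≤∣p∣+∣q∣ (inside ∷ p)  (inside ∷ q)  =
  s≤s (≤-trans (∣p∪q∣≤∣p∣+∣q∣ p q) (+-monoʳ-≤ ∣ p ∣ (n≤1+n ∣ q ∣)))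

∣p∪⁅x⁆∣≤1+∣p∣ : ∀ {n} (p : Subset n) (x : Fin n) → ∣ p ∪ ⁅ x ⁆ ∣ ≤ suc ∣ p ∣
∣p∪⁅x⁆∣≤1+∣p∣ p x = ≤-trans (∣p∪q∣≤∣p∣+∣q∣ p ⁅ x ⁆)
  (≤-reflexive (trans (cong (∣ p ∣ +_) (∣⁅x⁆∣≡1 x)) (+-comm ∣ p ∣ 1)))

∣⁅x⁆∪⁅y⁆∣≤2 : ∀ {n} (x y : Fin n) → ∣ ⁅ x ⁆ ∪ ⁅ y ⁆ ∣ ≤ 2
∣⁅x⁆∪⁅y⁆∣≤2 x y = ≤-trans (∣p∪⁅x⁆∣≤1+∣p∣ ⁅ x ⁆ y) (≤-reflexive (cong suc (∣⁅x⁆∣≡1 x)))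

module _ {n : ℕ} {x y : Fin n} where

  x∈⁅x⁆∪⁅y⁆ : x ∈ ⁅ x ⁆ ∪ ⁅ y ⁆
  x∈⁅x⁆∪⁅y⁆ = p⊆p∪q ⁅ y ⁆ (x∈⁅x⁆ x)

  y∈⁅x⁆∪⁅y⁆ : y ∈ ⁅ x ⁆ ∪ ⁅ y ⁆
  y∈⁅x⁆∪⁅y⁆ = q⊆p∪q ⁅ x ⁆ ⁅ y ⁆ (x∈⁅x⁆ y)

  z∈⁅x⁆∪⁅y⁆⇒ : ∀ {z} → z ∈ ⁅ x ⁆ ∪ ⁅ y ⁆ → z ≡ x ⊎ z ≡ y
  z∈⁅x⁆∪⁅y⁆⇒ z∈ = Sum.map (x∈⁅y⁆⇒x≡y x) (x∈⁅y⁆⇒x≡y y) (x∈p∪q⁻ ⁅ x ⁆ ⁅ y ⁆ z∈)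

∣q∣<∣p∣⇒∃∈p∉q : ∀ {n} {p q : Subset n} → ∣ q ∣ ℕ.< ∣ p ∣ → ∃ λ x → x ∈ p × x ∉ q
∣q∣<∣p∣⇒∃∈p∉q {p = p} {q} ∣q∣<∣p∣ with any? (λ x → (x ∈? p) ×-dec ¬? (x ∈? q))
... | yes found = found
... | no none   = ⊥-elim (<⇒≱ ∣q∣<∣p∣ (p⊆q⇒∣p∣≤∣q∣ p⊆q))
  where
  p⊆q : p ⊆ q
  p⊆q {x} x∈p with x ∈? q
  ... | yes x∈q = x∈q
  ... | no  x∉q = ⊥-elim (none (x , x∈p , x∉q))

∣q∣<n⇒∃∉q : ∀ {n} {q : Subset n} → ∣ q ∣ ℕ.< n → ∃ λ x → x ∉ q
∣q∣<n⇒∃∉q {n} ∣q∣<n =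
  map₂ proj₂ (∣q∣<∣p∣⇒∃∈p∉q {p = ⊤} (<-≤-trans ∣q∣<n (≤-reflexive (sym (∣⊤∣≡n n)))))

x∉p∧y∈p⇒x≢y : ∀ {n} {p : Subset n} {x y} → x ∉ p → y ∈ p → x ≢ y
x∉p∧y∈p⇒x≢y x∉p y∈p refl = x∉p y∈p

∃∉⁅x⁆ : ∀ {n} → 2 ≤ n → (x : Fin n) → ∃ λ y → y ∉ ⁅ x ⁆
∃∉⁅x⁆ {n} 2≤n x = ∣q∣<n⇒∃∉q (subst (ℕ._< n) (sym (∣⁅x⁆∣≡1 x)) 2≤n)

injective⇒surjective : ∀ {m k} {f : Fin m → Fin k} → Injective _≡_ _≡_ f → k ≤ m →
                       ∀ l → ∃ λ a → f a ≡ l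
injective⇒surjective {m} {suc k} {f} f-inj k≤m l with any? (λ a → f a ≟ l)
... | yes hit = hit
... | no miss = ⊥-elim (<⇒≱ k≤m (injective⇒≤ g-inj))
  where
  l≢f : ∀ a → l ≢ f a
  l≢f a l≡fa = miss (a , sym l≡fa)
  g : Fin m → Fin k
  g a = punchOut (l≢f a)
  g-inj : Injective _≡_ _≡_ g
  g-inj {a} {b} ga≡gb = f-inj (punchOut-injective (l≢f a) (l≢f b) ga≡gb)

Fin≤1-irrelevant : ∀ {k} → k ≤ 1 → (i j : Fin k) → i ≡ j
Fin≤1-irrelevant {1} _ zero zero = refl
Fin≤1-irrelevant {suc (suc _)} (s≤s ()) _ _

Fin≤2-cover : ∀ {k} → k ≤ 2 → {i j : Fin k} → i Fin.< j → ∀ l → l ≡ i ⊎ l ≡ j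
Fin≤2-cover {2} _ {zero} {suc zero} _ zero       = inj₁ refl
Fin≤2-cover {2} _ {zero} {suc zero} _ (suc zero) = inj₂ refl
Fin≤2-cover {suc (suc (suc _))} (s≤s (s≤s ())) _ _
Fin≤2-cover {1} _ {zero} {zero} () _
Fin≤2-cover {2} _ {zero} {zero} () _
Fin≤2-cover {2} _ {suc zero} {zero} () _
Fin≤2-cover {2} _ {suc zero} {suc zero} (s≤s ()) _

≡-pigeonhole : ∀ {A : Set} {a b x₁ x₂ x₃ : A} →
               x₁ ≡ a ⊎ x₁ ≡ b → x₂ ≡ a ⊎ x₂ ≡ b → x₃ ≡ a ⊎ x₃ ≡ b →
               x₁ ≡ x₂ ⊎ x₁ ≡ x₃ ⊎ x₂ ≡ x₃
≡-pigeonhole (inj₁ e₁) (inj₁ e₂) _         = inj₁ (trans e₁ (sym e₂))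
≡-pigeonhole (inj₂ e₁) (inj₂ e₂) _         = inj₁ (trans e₁ (sym e₂))
≡-pigeonhole (inj₁ e₁) (inj₂ _)  (inj₁ e₃) = inj₂ (inj₁ (trans e₁ (sym e₃)))
≡-pigeonhole (inj₂ e₁) (inj₁ _)  (inj₂ e₃) = inj₂ (inj₁ (trans e₁ (sym e₃)))
≡-pigeonhole (inj₁ _)  (inj₂ e₂) (inj₂ e₃) = inj₂ (inj₂ (trans e₂ (sym e₃)))
≡-pigeonhole (inj₂ _)  (inj₁ e₂) (inj₁ e₃) = inj₂ (inj₂ (trans e₂ (sym e₃)))

nonempty-subsets-unrealisable :
  ∀ {m k} → 2 ≤ m → k ≤ m → (B : Fin m → Subset k) →
  (∀ (T : Subset m) → Nonempty T → ∃ λ q → ∀ b → q ∈ B b ⇔ b ∈ T) → ⊥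
nonempty-subsets-unrealisable {suc m} {k} 2≤m k≤m B realise = absurd
  where
  point : Fin (suc m) → Fin k
  point a = proj₁ (realise ⁅ a ⁆ (a , x∈⁅x⁆ a))
  point-∈ : ∀ a b → point a ∈ B b ⇔ b ∈ ⁅ a ⁆
  point-∈ a = proj₂ (realise ⁅ a ⁆ (a , x∈⁅x⁆ a))
  point-injective : Injective _≡_ _≡_ point
  point-injective {a} {b} pa≡pb =
    x∈⁅y⁆⇒x≡y b (to (point-∈ b a) (subst (_∈ B a) pa≡pb (from (point-∈ a a) (x∈⁅x⁆ a))))
  absurd : ⊥
  absurd with q , q-∈ ← realise ⊤ (zero , ∈⊤)
         with a , pa≡q ← injective⇒surjective point-injective k≤m q
         with b , b∉⁅a⁆ ← ∃∉⁅x⁆ 2≤m a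
    = b∉⁅a⁆ (to (point-∈ a b) (subst (_∈ B b) (sym pa≡q) (from (q-∈ b) ∈⊤)))

module Witnesses {V : Set} (Adj : V → V → Set) {m : ℕ} (S : Fin m → V) (sh : Shattered Adj S) where

  witness : Subset m → V
  witness T = proj₁ (sh T)

  witness-adj : ∀ {T j} → j ∈ T → Adj (witness T) (S j)
  witness-adj {T} {j} = from (proj₂ (sh T) j)

  witness-adj⁻¹ : ∀ {T j} → Adj (witness T) (S j) → j ∈ T
  witness-adj⁻¹ {T} {j} = to (proj₂ (sh T) j)

  witness-≡⇒⊆ : ∀ {T T′} → witness T ≡ witness T′ → T ⊆ T′
  witness-≡⇒⊆ w≡w′ {j} j∈T = witness-adj⁻¹ (subst (λ w → Adj w (S j)) w≡w′ (witness-adj j∈T))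

Shattered-cong : ∀ {V : Set} (Adj : V → V → Set) {m} {S S′ : Fin m → V} →
                 (∀ j → S j ≡ S′ j) → Shattered Adj S → Shattered Adj S′
Shattered-cong Adj S≡S′ sh T =
  proj₁ (sh T) , λ j → subst (λ v → Adj (proj₁ (sh T)) v ⇔ (j ∈ T)) (S≡S′ j) (proj₂ (sh T) j)

module _ (n : ℕ) (Adj′ : Fin n → Fin n → Set) (k : ℕ) (part : Fin n → Fin k) where

  open Construction n Adj′ k part

  consistent-family-coloring : (c : ∀ l → U l) →
                               (∀ {l l′} → l Fin.< l′ → Consistent (c l) (c l′)) →
                               Proper3Coloring n Adj′
  consistent-family-coloring c consistent = color , color-proper
    where
    color : Fin n → Fin 3
    color v = col (c (part v)) (v , refl)
    color-≡ : ∀ {v l} (e : part v ≡ l) → col (c l) (v , e) ≡ color v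
    color-≡ refl = refl
    color-proper : ∀ a b → Adj′ a b → color a ≢ color b
    color-proper a b adj with <-cmp (part a) (part b)
    ... | tri< a<b _ _ = consistent a<b a b (inj₁ refl) (inj₂ refl) adj
    ... | tri> _ _ b<a = consistent b<a a b (inj₂ refl) (inj₁ refl) adj
    ... | tri≈ _ a≡b _ = λ ca≡cb →
      proper (c (part a)) (a , refl) (b , sym a≡b) adj (trans ca≡cb (sym (color-≡ (sym a≡b))))

  one-part-coloring : k ≤ 1 → X → Proper3Coloring n Adj′
  one-part-coloring k≤1 (i , c) =
    (λ v → col c (v , Fin≤1-irrelevant k≤1 (part v) i)) , λ a b → proper c _ _

  two-part-coloring : k ≤ 2 → ∀ {i j} → i Fin.< j → (c : U i) (d : U j) → Consistent c d →
                       Proper3Coloring n Adj′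
  two-part-coloring k≤2 i<j c d consistent =
    (λ v → unionCol c d v (cover v)) , λ a b → consistent a b (cover a) (cover b)
    where
    cover : ∀ v → part v ≡ _ ⊎ part v ≡ _
    cover v = Fin≤2-cover k≤2 i<j (part v)

  Consistent-subst : ∀ {y z : X} {l l′} (e : proj₁ y ≡ l) (e′ : proj₁ z ≡ l′) →
                     Consistent (proj₂ y) (proj₂ z) →
                     Consistent (subst U e (proj₂ y)) (subst U e′ (proj₂ z))
  Consistent-subst refl refl consistent = consistent

  IsX : VG → Set
  IsX v = ∃ λ x → v ≡ xv x

  IsX? : ∀ v → Dec (IsX v)
  IsX? (xv x)           = yes (x , refl)
  IsX? (i₁ _)           = no λ ()
  IsX? (i₂ _ _ _ _ _)   = no λ ()
  IsX? (i≥3 _ _)        = no λ ()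

  IsI≥3 : VG → Set
  IsI≥3 v = ∃ λ B → Σ (3 ≤ ∣ B ∣) λ h → v ≡ i≥3 B h

  IsI≥3? : ∀ v → Dec (IsI≥3 v)
  IsI≥3? (xv _)         = no λ ()
  IsI≥3? (i₁ _)         = no λ ()
  IsI≥3? (i₂ _ _ _ _ _) = no λ ()
  IsI≥3? (i≥3 B h)      = yes (B , h , refl)

  edge-meets-X : ∀ w v → AdjG w v → IsX w ⊎ IsX v
  edge-meets-X (xv x) _      _  = inj₁ (x , refl)
  edge-meets-X _      (xv x) _  = inj₂ (x , refl)
  edge-meets-X (i₁ _)           (i₁ _)           ()
  edge-meets-X (i₁ _)           (i₂ _ _ _ _ _)   ()
  edge-meets-X (i₁ _)           (i≥3 _ _)        ()
  edge-meets-X (i₂ _ _ _ _ _)   (i₁ _)           ()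
  edge-meets-X (i₂ _ _ _ _ _)   (i₂ _ _ _ _ _)   ()
  edge-meets-X (i₂ _ _ _ _ _)   (i≥3 _ _)        ()
  edge-meets-X (i≥3 _ _)        (i₁ _)           ()
  edge-meets-X (i≥3 _ _)        (i₂ _ _ _ _ _)   ()
  edge-meets-X (i≥3 _ _)        (i≥3 _ _)        ()

  adj-i₁ : ∀ w {u} → AdjG w (i₁ u) → w ≡ xv u
  adj-i₁ (xv _) refl = refl

  adj-i₂ : ∀ w {i j i<j c d} → AdjG w (i₂ i j i<j c d) →
           Consistent c d × (w ≡ xv (i , c) ⊎ w ≡ xv (j , d))
  adj-i₂ (xv _) (consistent , inj₁ refl) = consistent , inj₁ refl
  adj-i₂ (xv _) (consistent , inj₂ refl) = consistent , inj₂ refl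

  i₂-sees-pair : ∀ {i j i<j c d} {y z : X} →
                 AdjG (i₂ i j i<j c d) (xv y) → AdjG (i₂ i j i<j c d) (xv z) → y ≢ z →
                 proj₁ y Fin.< proj₁ z × Consistent (proj₂ y) (proj₂ z) ⊎
                 proj₁ z Fin.< proj₁ y × Consistent (proj₂ z) (proj₂ y)
  i₂-sees-pair {i<j = i<j} (consistent , inj₁ refl) (_ , inj₂ refl) _ = inj₁ (i<j , consistent)
  i₂-sees-pair {i<j = i<j} (consistent , inj₂ refl) (_ , inj₁ refl) _ = inj₂ (i<j , consistent)
  i₂-sees-pair (_ , inj₁ refl) (_ , inj₁ refl) y≢z = ⊥-elim (y≢z refl)
  i₂-sees-pair (_ , inj₂ refl) (_ , inj₂ refl) y≢z = ⊥-elim (y≢z refl)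

  module XCase {m} (x : Fin m → X) (x-injective : Injective _≡_ _≡_ x) (k≤m : k ≤ m)
               (sh : Shattered AdjG (xv ∘ x)) where

    p : Fin m → Fin k
    p = proj₁ ∘ x

    Trace : VG → Subset m → Set
    Trace w T = ∀ a → AdjG w (xv (x a)) ⇔ a ∈ T

    -- For a ≠ b in one part: only an I≥3-vertex could trace ⁅a,b⁆, and when m ≤ 3 it sees all
    -- of X; when m ≥ 4, ∁⁅b⁆ has at least three elements, too many for I₁ ∪ I₂, and an
    -- I≥3-vertex seeing a also sees b.
    same-part-untraceable-pair : m ≤ 3 → ∀ {a b} → a ≢ b → p a ≡ p b →
                                 ∀ w → Trace w (⁅ a ⁆ ∪ ⁅ b ⁆) → ⊥
    same-part-untraceable-pair _ _ _ (xv _) trace = from (trace _) x∈⁅x⁆∪⁅y⁆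
    same-part-untraceable-pair _ a≢b _ (i₁ _) trace =
      a≢b (x-injective (trans (from (trace _) x∈⁅x⁆∪⁅y⁆) (sym (from (trace _) y∈⁅x⁆∪⁅y⁆))))
    same-part-untraceable-pair _ {a} {b} a≢b pa≡pb (i₂ i j i<j c d) trace
      with i₂-sees-pair {i} {j} {i<j} {c} {d}
             (from (trace a) x∈⁅x⁆∪⁅y⁆) (from (trace b) y∈⁅x⁆∪⁅y⁆) (a≢b ∘ x-injective)
    ... | inj₁ (pa<pb , _) = <-irrefl pa≡pb pa<pb
    ... | inj₂ (pb<pa , _) = <-irrefl (sym pa≡pb) pb<pa
    same-part-untraceable-pair m≤3 {a} {b} _ _ (i≥3 B 3≤∣B∣) trace
      with c , c∉ ← ∣q∣<n⇒∃∉q {q = ⁅ a ⁆ ∪ ⁅ b ⁆}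
                       (≤-<-trans (∣⁅x⁆∪⁅y⁆∣≤2 a b) (≤-trans 3≤∣B∣ (≤-trans (∣p∣≤n B) k≤m)))
      = c∉ (to (trace c) (subst (p c ∈_) (sym B≡⊤) ∈⊤))
      where
      B≡⊤ : B ≡ ⊤
      B≡⊤ = ∣p∣≡n⇒p≡⊤ (≤-antisym (∣p∣≤n B) (≤-trans (≤-trans k≤m m≤3) 3≤∣B∣))

    same-part-untraceable-co-singleton : 4 ≤ m → ∀ {a b} → a ≢ b → p a ≡ p b →
                                         ∀ w → Trace w (∁ ⁅ b ⁆) → ⊥
    same-part-untraceable-co-singleton 4≤m {a} {b} a≢b pa≡pb
      with c , c∉ ← ∣q∣<n⇒∃∉q {q = ⁅ a ⁆ ∪ ⁅ b ⁆}
                      (≤-<-trans (∣⁅x⁆∪⁅y⁆∣≤2 a b) (≤-trans (n≤1+n 3) 4≤m))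
      with d , d∉ ← ∣q∣<n⇒∃∉q {q = (⁅ a ⁆ ∪ ⁅ b ⁆) ∪ ⁅ c ⁆}
                      (≤-<-trans (≤-trans (∣p∪⁅x⁆∣≤1+∣p∣ (⁅ a ⁆ ∪ ⁅ b ⁆) c)
                                          (s≤s (∣⁅x⁆∪⁅y⁆∣≤2 a b)))
                                 4≤m)
      = untraceable
      where
      ≢b⇒∈ : ∀ {z} → z ≢ b → z ∈ ∁ ⁅ b ⁆
      ≢b⇒∈ = x∉p⇒x∈∁p ∘ x≢y⇒x∉⁅y⁆
      c≢a : c ≢ a
      c≢a = x∉p∧y∈p⇒x≢y c∉ x∈⁅x⁆∪⁅y⁆
      d≢a : d ≢ a
      d≢a = x∉p∧y∈p⇒x≢y d∉ (p⊆p∪q ⁅ c ⁆ x∈⁅x⁆∪⁅y⁆)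
      d≢c : d ≢ c
      d≢c = x∉p∧y∈p⇒x≢y d∉ (q⊆p∪q (⁅ a ⁆ ∪ ⁅ b ⁆) ⁅ c ⁆ (x∈⁅x⁆ c))
      a∈ : a ∈ ∁ ⁅ b ⁆
      a∈ = ≢b⇒∈ a≢b
      c∈ : c ∈ ∁ ⁅ b ⁆
      c∈ = ≢b⇒∈ (x∉p∧y∈p⇒x≢y c∉ y∈⁅x⁆∪⁅y⁆)
      d∈ : d ∈ ∁ ⁅ b ⁆
      d∈ = ≢b⇒∈ (x∉p∧y∈p⇒x≢y d∉ (p⊆p∪q ⁅ c ⁆ y∈⁅x⁆∪⁅y⁆))
      untraceable : ∀ w → Trace w (∁ ⁅ b ⁆) → ⊥
      untraceable (xv _) trace = from (trace a) a∈
      untraceable (i₁ _) trace =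
        c≢a (x-injective (trans (from (trace c) c∈) (sym (from (trace a) a∈))))
      untraceable (i₂ _ _ _ _ _) trace
        with ≡-pigeonhole (proj₂ (from (trace a) a∈)) (proj₂ (from (trace c) c∈))
                          (proj₂ (from (trace d) d∈))
      ... | inj₁ xa≡xc        = c≢a (sym (x-injective xa≡xc))
      ... | inj₂ (inj₁ xa≡xd) = d≢a (sym (x-injective xa≡xd))
      ... | inj₂ (inj₂ xc≡xd) = d≢c (sym (x-injective xc≡xd))
      untraceable (i≥3 B _) trace =
        x∈∁p⇒x∉p (to (trace b) (subst (_∈ B) pa≡pb (from (trace a) a∈))) (x∈⁅x⁆ b)

    p-injective : Injective _≡_ _≡_ p
    p-injective {a} {b} pa≡pb with a ≟ b | m ≤? 3
    ... | yes a≡b | _       = a≡b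
    ... | no a≢b  | yes m≤3 =
      ⊥-elim (uncurry (same-part-untraceable-pair m≤3 a≢b pa≡pb) (sh (⁅ a ⁆ ∪ ⁅ b ⁆)))
    ... | no a≢b  | no m≰3  =
      ⊥-elim (uncurry (same-part-untraceable-co-singleton (≰⇒> m≰3) a≢b pa≡pb) (sh (∁ ⁅ b ⁆)))

    p-surjective : ∀ l → ∃ λ a → p a ≡ l
    p-surjective = injective⇒surjective p-injective k≤m

    pair-trace⇒consistent : ∀ {a b} → p a Fin.< p b → ∀ w → Trace w (⁅ a ⁆ ∪ ⁅ b ⁆) →
                            Consistent (proj₂ (x a)) (proj₂ (x b))
    pair-trace⇒consistent _ (xv _) trace = ⊥-elim (from (trace _) x∈⁅x⁆∪⁅y⁆)
    pair-trace⇒consistent {a} {b} pa<pb (i₁ _) trace =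
      ⊥-elim (<-irrefl (cong p (x-injective xa≡xb)) pa<pb)
      where
      xa≡xb : x a ≡ x b
      xa≡xb = trans (from (trace a) x∈⁅x⁆∪⁅y⁆) (sym (from (trace b) y∈⁅x⁆∪⁅y⁆))
    pair-trace⇒consistent {a} {b} pa<pb (i₂ i j i<j c d) trace
      with i₂-sees-pair {i} {j} {i<j} {c} {d}
             (from (trace a) x∈⁅x⁆∪⁅y⁆) (from (trace b) y∈⁅x⁆∪⁅y⁆)
             (λ xa≡xb → <-irrefl (cong proj₁ xa≡xb) pa<pb)
    ... | inj₁ (_ , consistent) = consistent
    ... | inj₂ (pb<pa , _)      = ⊥-elim (<-asym pa<pb pb<pa)
    pair-trace⇒consistent {a} {b} _ (i≥3 B 3≤∣B∣) trace
      with l , l∈B , l∉ ← ∣q∣<∣p∣⇒∃∈p∉q {p = B} {q = ⁅ p a ⁆ ∪ ⁅ p b ⁆}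
                            (≤-<-trans (∣⁅x⁆∪⁅y⁆∣≤2 (p a) (p b)) 3≤∣B∣)
      with c , pc≡l ← p-surjective l
      with z∈⁅x⁆∪⁅y⁆⇒ (to (trace c) (subst (_∈ B) (sym pc≡l) l∈B))
    ... | inj₁ refl = ⊥-elim (l∉ (subst (_∈ ⁅ p a ⁆ ∪ ⁅ p b ⁆) pc≡l x∈⁅x⁆∪⁅y⁆))
    ... | inj₂ refl = ⊥-elim (l∉ (subst (_∈ ⁅ p a ⁆ ∪ ⁅ p b ⁆) pc≡l y∈⁅x⁆∪⁅y⁆))

    coloring : Proper3Coloring n Adj′
    coloring = consistent-family-coloring (λ l → subst U (sel-p l) (proj₂ (x (sel l)))) consistent
      where
      sel : Fin k → Fin m
      sel l = proj₁ (p-surjective l)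
      sel-p : ∀ l → p (sel l) ≡ l
      sel-p l = proj₂ (p-surjective l)
      consistent : ∀ {l l′} → l Fin.< l′ →
                   Consistent (subst U (sel-p l) (proj₂ (x (sel l))))
                              (subst U (sel-p l′) (proj₂ (x (sel l′))))
      consistent {l} {l′} l<l′ =
        Consistent-subst (sel-p l) (sel-p l′)
          (uncurry (pair-trace⇒consistent (subst₂ Fin._<_ (sym (sel-p l)) (sym (sel-p l′)) l<l′))
                   (sh (⁅ sel l ⁆ ∪ ⁅ sel l′ ⁆)))

  module YCase {m} (S : Fin m → VG) (k≤m : k ≤ m) (sh : Shattered AdjG S)
               (x₀ : X) (x₀-adj : ∀ a → AdjG (xv x₀) (S a)) where

    open Witnesses AdjG S sh

    witness-i₁ : ∀ {a u T} → S a ≡ i₁ u → a ∈ T → witness T ≡ xv u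
    witness-i₁ {T = T} S≡ a∈T =
      adj-i₁ (witness T) (subst (AdjG (witness T)) S≡ (witness-adj a∈T))

    witness-i₂ : ∀ {a i j i<j c d T} → S a ≡ i₂ i j i<j c d → a ∈ T →
                 Consistent c d × (witness T ≡ xv (i , c) ⊎ witness T ≡ xv (j , d))
    witness-i₂ {T = T} S≡ a∈T =
      adj-i₂ (witness T) (subst (AdjG (witness T)) S≡ (witness-adj a∈T))

    i₁-unshatterable : 2 ≤ m → ∀ {a u} → S a ≡ i₁ u → ⊥
    i₁-unshatterable 2≤m {a} S≡ with b , b∉⁅a⁆ ← ∃∉⁅x⁆ 2≤m a =
      b∉⁅a⁆ (witness-≡⇒⊆ (trans (witness-i₁ S≡ x∈⁅x⁆∪⁅y⁆) (sym (witness-i₁ S≡ (x∈⁅x⁆ a))))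
                         y∈⁅x⁆∪⁅y⁆)

    i₂-unshatterable : 3 ≤ m → ∀ {a i j i<j c d} → S a ≡ i₂ i j i<j c d → ⊥
    i₂-unshatterable 3≤m {a} S≡
      with b , b∉ ← ∃∉⁅x⁆ (≤-trans (n≤1+n 2) 3≤m) a
      with b′ , b′∉ ← ∣q∣<n⇒∃∉q {q = ⁅ a ⁆ ∪ ⁅ b ⁆} (≤-<-trans (∣⁅x⁆∪⁅y⁆∣≤2 a b) 3≤m)
      with ≡-pigeonhole (proj₂ (witness-i₂ S≡ (x∈⁅x⁆ a)))
                        (proj₂ (witness-i₂ S≡ (x∈⁅x⁆∪⁅y⁆ {y = b})))
                        (proj₂ (witness-i₂ S≡ (x∈⁅x⁆∪⁅y⁆ {y = b′})))
    ... | inj₁ w≡w₂        = b∉ (witness-≡⇒⊆ (sym w≡w₂) y∈⁅x⁆∪⁅y⁆)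
    ... | inj₂ (inj₁ w≡w₃) = b′∉ (p⊆p∪q ⁅ b ⁆ (witness-≡⇒⊆ (sym w≡w₃) y∈⁅x⁆∪⁅y⁆))
    ... | inj₂ (inj₂ w₂≡w₃) with z∈⁅x⁆∪⁅y⁆⇒ (witness-≡⇒⊆ w₂≡w₃ y∈⁅x⁆∪⁅y⁆)
    ...   | inj₁ refl = b∉ (x∈⁅x⁆ _)
    ...   | inj₂ refl = b′∉ y∈⁅x⁆∪⁅y⁆

    i₂-coloring : ∀ {a i j i<j c d} → S a ≡ i₂ i j i<j c d → Proper3Coloring n Adj′
    i₂-coloring {a} {i<j = i<j} {c} {d} S≡ with k ≤? 2
    ... | yes k≤2 = two-part-coloring k≤2 i<j c d (proj₁ (witness-i₂ S≡ (x∈⁅x⁆ a)))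
    ... | no k≰2  = ⊥-elim (i₂-unshatterable (≤-trans (≰⇒> k≰2) k≤m) S≡)

    all-I≥3-unshatterable : 2 ≤ m → (∀ a → IsI≥3 (S a)) → ⊥
    all-I≥3-unshatterable 2≤m all-I≥3 = nonempty-subsets-unrealisable 2≤m k≤m B realise
      where
      B : Fin m → Subset k
      B a = proj₁ (all-I≥3 a)
      sh′ : Shattered AdjG (λ a → i≥3 (B a) (proj₁ (proj₂ (all-I≥3 a))))
      sh′ = Shattered-cong AdjG (λ a → proj₂ (proj₂ (all-I≥3 a))) sh
      realise : ∀ T → Nonempty T → ∃ λ q → ∀ b → q ∈ B b ⇔ b ∈ T
      realise T (a , a∈T) with sh′ T
      ... | xv (q , _)     , trace = q , trace
      ... | i₁ _           , trace = ⊥-elim (from (trace a) a∈T)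
      ... | i₂ _ _ _ _ _   , trace = ⊥-elim (from (trace a) a∈T)
      ... | i≥3 _ _        , trace = ⊥-elim (from (trace a) a∈T)

    coloring : Proper3Coloring n Adj′
    coloring with k ≤? 1
    ... | yes k≤1 = one-part-coloring k≤1 x₀
    ... | no k≰1 with all? (λ a → IsI≥3? (S a))
    ...   | yes all-I≥3 = ⊥-elim (all-I≥3-unshatterable (≤-trans (≰⇒> k≰1) k≤m) all-I≥3)
    ...   | no ¬all-I≥3 with ¬∀⟶∃¬ m _ (λ a → IsI≥3? (S a)) ¬all-I≥3
    ...     | a , ¬I≥3 with S a in S≡
    ...       | xv _         = ⊥-elim (subst (AdjG (xv x₀)) S≡ (x₀-adj a))
    ...       | i₁ _         = ⊥-elim (i₁-unshatterable (≤-trans (≰⇒> k≰1) k≤m) S≡)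
    ...       | i₂ _ _ _ _ _ = i₂-coloring S≡
    ...       | i≥3 B h      = ⊥-elim (¬I≥3 (B , h , refl))

  shattered⇒proper3Coloring : ∀ {m} (S : Fin m → VG) → k ≤ m → Injective _≡_ _≡_ S →
                              Shattered AdjG S → Proper3Coloring n Adj′
  shattered⇒proper3Coloring S k≤m S-injective sh with IsX? (Witnesses.witness AdjG S sh ⊤)
  ... | yes (x₀ , w≡x₀) = YCase.coloring S k≤m sh x₀ x₀-adj
    where
    x₀-adj : ∀ a → AdjG (xv x₀) (S a)
    x₀-adj a = subst (λ w → AdjG w (S a)) w≡x₀ (Witnesses.witness-adj AdjG S sh ∈⊤)
  ... | no w∉X = XCase.coloring x x-injective k≤m (Shattered-cong AdjG S≡xv∘x sh)
    where
    S∈X : ∀ a → IsX (S a)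
    S∈X a = [ ⊥-elim ∘ w∉X , id ]′ (edge-meets-X _ _ (Witnesses.witness-adj AdjG S sh ∈⊤))
    x : _ → X
    x = proj₁ ∘ S∈X
    S≡xv∘x : ∀ a → S a ≡ xv (x a)
    S≡xv∘x = proj₂ ∘ S∈X
    x-injective : Injective _≡_ _≡_ x
    x-injective {a} {b} xa≡xb =
      S-injective (trans (S≡xv∘x a) (trans (cong xv xa≡xb) (sym (S≡xv∘x b))))

lemma2 : (n : ℕ) (Adj' : Fin n → Fin n → Set)
    → (∀ u v → Adj' u v → Adj' v u)
    → (∀ v → Adj' v v → ⊥)
    → (ε₁ : ℚ) (0<ε₁ : 0ℚ < ε₁) → ε₁ < 1ℚ
    → (part : Fin n → Fin (kOf ε₁ n))
    → (∀ i → ∃[ v ] part v ≡ i)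
    → (∀ i → partSize part i ≤ pOf ε₁ 0<ε₁)
    → HasShatteredSetOfSize≥ (Construction.AdjG n Adj' (kOf ε₁ n) part) (kOf ε₁ n)
    → Proper3Coloring n Adj'
lemma2 n Adj' _ _ ε₁ _ _ part _ _ (_ , S , k≤m , S-injective , sh) =
  shattered⇒proper3Coloring n Adj' (kOf ε₁ n) part S k≤m S-injective sh
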